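{- For every integer $n\geq 0$, $$\sum_{k=0}^{n}(k+1)A_{n,k}=(n+2)B_{n+1}-V_{n+3},\qquad \sum_{k=0}^{n}(n-k+1)A_{n,k}=V_{n+3}-(n+2)V_{n+1}.$$
   Context: A partition of a finite set is a collection of nonempty, pairwise disjoint subsets (blocks) whose union is the set; a singleton of a partition is a block with exactly one element. $B_n$ denotes the $n$-th Bell number ($B_0=1$), and $V_n$ the number of partitions of $\{1,\dots,n\}$ with no singletons ($V_0=1$). For integers $0\leq k\leq n$, $A_{n,k}$ denotes the number of partitions of $\{1,2,\dots,n+1\}$ whose largest singleton is $k+1$ (i.e. $\{k+1\}$ is a block and no $j>k+1$ forms a singleton block). -}

module Defs where

open import Data.Nat using (ℕ; zero; suc; _+_; _*_)
open import Data.Bool using (Bool; true; false)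
open import Data.Fin using (Fin; toℕ; _<_; fromℕ<)
open import Data.Fin.Properties using (all?; _≟_; _<?_)
open import Data.Vec using (Vec; []; _∷_; lookup)
open import Data.List using (List; []; _∷_; concatMap; map; length; filter; allFin)
open import Data.Nat.ListAction using (sum)
open import Data.Product using (_×_; _,_)
open import Relation.Nullary using (¬_; Dec; ¬?; _×-dec_; _→-dec_)
open import Relation.Binary.PropositionalEquality using (_≡_)
open import Data.Bool.Properties using () renaming (_≟_ to _≟ᵇ_)

vecs : {A : Set} → List A → (n : ℕ) → List (Vec A n)
vecs xs zero    = [] ∷ []
vecs xs (suc n) = concatMap (λ x → map (x ∷_) (vecs xs n)) xs

BRel : ℕ → Set
BRel n = Vec (Vec Bool n) n

allBRel : (n : ℕ) → List (BRel n)
allBRel n = vecs (vecs (true ∷ false ∷ []) n) n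

rel : {n : ℕ} → BRel n → Fin n → Fin n → Set
rel R i j = lookup (lookup R i) j ≡ true

rel? : {n : ℕ} (R : BRel n) (i j : Fin n) → Dec (rel R i j)
rel? R i j = lookup (lookup R i) j ≟ᵇ true

-- A partition of Fin n, encoded as its equivalence relation
-- ("i and j lie in the same block").
IsPartition : {n : ℕ} → BRel n → Set
IsPartition R = (∀ i → rel R i i)
              × (∀ i j → rel R i j → rel R j i)
              × (∀ i j k → rel R i j → rel R j k → rel R i k)

isPartition? : {n : ℕ} (R : BRel n) → Dec (IsPartition R)
isPartition? R =
  all? (λ i → rel? R i i)
  ×-dec all? (λ i → all? (λ j → rel? R i j →-dec rel? R j i))
  ×-dec all? (λ i → all? (λ j → all? (λ k →
          rel? R i j →-dec (rel? R j k →-dec rel? R i k))))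

IsSingleton : {n : ℕ} → BRel n → Fin n → Set
IsSingleton R i = ∀ j → rel R i j → j ≡ i

isSingleton? : {n : ℕ} (R : BRel n) (i : Fin n) → Dec (IsSingleton R i)
isSingleton? R i = all? (λ j → rel? R i j →-dec (j ≟ i))

B : ℕ → ℕ
B n = length (filter isPartition? (allBRel n))

NoSingletons : {n : ℕ} → BRel n → Set
NoSingletons R = ∀ i → ¬ IsSingleton R i

noSingletons? : {n : ℕ} (R : BRel n) → Dec (NoSingletons R)
noSingletons? R = all? (λ i → ¬? (isSingleton? R i))

V : ℕ → ℕ
V n = length (filter (λ R → isPartition? R ×-dec noSingletons? R) (allBRel n))

LargestSingleton : {n : ℕ} → BRel n → Fin n → Set
LargestSingleton R k = IsSingleton R k × (∀ j → k < j → ¬ IsSingleton R j)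

largestSingleton? : {n : ℕ} (R : BRel n) (k : Fin n) → Dec (LargestSingleton R k)
largestSingleton? R k =
  isSingleton? R k ×-dec all? (λ j → (k <? j) →-dec ¬? (isSingleton? R j))

-- A n k for k ≤ n (k : Fin (suc n)): partitions of {1,…,n+1} whose largest
-- singleton is k+1.  Elements 1,…,n+1 are represented by Fin (suc n) with
-- element m+1 ↦ index m, so the element k+1 is the index k.
A : (n : ℕ) → Fin (suc n) → ℕ
A n k = length (filter (λ R → isPartition? R ×-dec largestSingleton? R k)
                       (allBRel (suc n)))

sumTo : (n : ℕ) → (Fin (suc n) → ℕ) → ℕ
sumTo n f = sum (map f (allFin (suc n)))

{-# OPTIONS --safe #-}
module Submission where

-- Let D m k (countNoSingletonFrom m k) count the partitions of {0,…,m−1} with no singleton among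
-- k,…,m−1, so that D m 0 = V m and D m m = B m. Deleting the singleton {k} identifies the partitions
-- counted by A n k with those counted by D n k, and splitting according to whether k is a singleton
-- gives D (n+1) (k+1) = D (n+1) k + A n k. Absorbing all singletons into the block of a new element
-- is a bijection from the partitions of an m-set onto the partitions of an (m+1)-set in which only
-- the new element may be a singleton, so B m = D (m+1) 1 = V (m+1) + V m. Telescoping the recurrence
-- gives B (n+1) = V (n+1) + Σ A n k and V (n+3) = Σ_{k≤n+1} D (n+1) k, and Abel summation gives
-- Σ (k+1) A n k + Σ_{k≤n} D (n+1) k = (n+1) B (n+1). The first identity follows, and the second
-- because the weights k+1 and n−k+1 add up to n+2.

open import Defs
open import Level using (0ℓ)
open import Data.Nat using (ℕ; zero; suc; _+_; _*_; _∸_; _≤_; _<_; z≤n; s≤s; s≤s⁻¹; _≤?_)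
open import Data.Nat.Properties
  using (+-suc; +-comm; +-assoc; +-identityʳ; *-zeroʳ; *-distribˡ-+; *-distribʳ-+; +-cancelˡ-≡;
         ≤-refl; ≤-trans; n≤1+n; m<n⇒m<1+n; m≤n⇒m<n∨m≡n; <-irrefl; m+[n∸m]≡n; +-commutativeSemigroup)
open import Algebra.Properties.CommutativeSemigroup +-commutativeSemigroup using () renaming (interchange to +-interchange)
open import Data.Nat.Tactic.RingSolver using (solve-∀)
open import Data.Nat.ListAction using (sum)
open import Data.Bool using (Bool; true; false)
open import Data.Empty using (⊥)
open import Data.Unit using (⊤; tt)
open import Data.Fin using (Fin; toℕ; fromℕ<; punchIn; punchOut)
  renaming (zero to 0F; suc to sucF)
open import Data.Fin.Properties
  using (all?; any?; _≟_; suc-injective; toℕ-injective; toℕ-fromℕ<; toℕ<n;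
         punchIn-injective; punchInᵢ≢i; punchIn-punchOut)
open import Data.Vec using (Vec; []; _∷_; lookup; tabulate; insertAt; replicate)
  renaming (map to mapᵥ)
open import Data.Vec.Properties
  using (∷-injective; lookup∘tabulate; tabulate∘lookup; tabulate-cong; lookup-map; lookup-replicate;
         insertAt-lookup; insertAt-punchIn)
open import Data.List using (List; []; _∷_; _++_; length; filter; map; concatMap; cartesianProductWith)
  renaming (tabulate to tabulateˡ)
open import Data.List.Properties using (length-map; map-id-local; map-∘; filter-≐; map-tabulate)
open import Data.List.Membership.Propositional using (_∈_)
open import Data.List.Membership.Propositional.Properties
  using (∈-filter⁺; ∈-filter⁻; ∈-map⁺; ∈-map⁻; ∈-cartesianProductWith⁺)
open import Data.List.Membership.Propositional.Properties.WithK using (unique∧set⇒bag)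
open import Data.List.Relation.Unary.Any using (here; there)
open import Data.List.Relation.Unary.All using ([]; _∷_) renaming (tabulate to tabulateᴬ)
open import Data.List.Relation.Unary.Unique.Propositional using (Unique; []; _∷_)
import Data.List.Relation.Unary.Unique.Propositional.Properties as Unique
open import Data.List.Relation.Binary.BagAndSetEquality using (∼bag⇒↭)
open import Data.List.Relation.Binary.Permutation.Propositional.Properties using (↭-length)
open import Data.Product using (_×_; _,_; proj₁; proj₂; ∃-syntax)
open import Data.Sum using (_⊎_; inj₁; inj₂)
open import Function.Bundles using (_⇔_; mk⇔; Equivalence)
import Function.Properties.Equivalence as ⇔
open import Relation.Binary.Structures using (IsEquivalence)
open import Relation.Nullary using (¬_; Dec; yes; no; does; ¬?; _×-dec_; _⊎-dec_; _→-dec_; contradiction)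
open import Relation.Nullary.Decidable using (decidable-stable)
open import Relation.Unary using (Pred; Decidable; _∩_; ∁; _≐_)
open import Relation.Unary.Properties using (_∩?_; ∁?)
open import Relation.Binary.PropositionalEquality
  using (_≡_; _≢_; refl; sym; trans; cong; cong₂; subst; module ≡-Reasoning)

open Equivalence using (to; from)

length-filter-split : {A : Set} {P Q : Pred A 0ℓ} (P? : Decidable P) (Q? : Decidable Q) (xs : List A) →
  length (filter P? xs) ≡ length (filter (P? ∩? Q?) xs) + length (filter (P? ∩? ∁? Q?) xs)
length-filter-split P? Q? [] = refl
length-filter-split P? Q? (x ∷ xs) with P? x | Q? x
... | yes _ | yes _ = cong suc (length-filter-split P? Q? xs)
... | yes _ | no _  = trans (cong suc (length-filter-split P? Q? xs)) (sym (+-suc _ _))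
... | no _  | _     = length-filter-split P? Q? xs

length-filter-bij : {A B : Set} {P : Pred A 0ℓ} {Q : Pred B 0ℓ} (P? : Decidable P) (Q? : Decidable Q)
  {xs : List A} {ys : List B} → Unique xs → Unique ys → (∀ x → x ∈ xs) → (∀ y → y ∈ ys) →
  (f : A → B) (g : B → A) → (∀ {x} → P x → Q (f x)) → (∀ {y} → Q y → P (g y)) →
  (∀ {x} → P x → g (f x) ≡ x) → (∀ {y} → Q y → f (g y) ≡ y) →
  length (filter P? xs) ≡ length (filter Q? ys)
length-filter-bij {P = P} {Q} P? Q? {xs} {ys} !xs !ys xs-all ys-all f g f-pres g-pres gf fg = begin
  length (filter P? xs)         ≡⟨ length-map f (filter P? xs) ⟨
  length (map f (filter P? xs))
    ≡⟨ ↭-length (∼bag⇒↭ (unique∧set⇒bag !image (Unique.filter⁺ Q? !ys) (mk⇔ image⊆ image⊇))) ⟩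
  length (filter Q? ys)         ∎
  where
  open ≡-Reasoning
  P-filter : ∀ {x} → x ∈ filter P? xs → P x
  P-filter x∈ = proj₂ (∈-filter⁻ P? {xs = xs} x∈)
  g∘f≡id : map g (map f (filter P? xs)) ≡ filter P? xs
  g∘f≡id = trans (sym (map-∘ (filter P? xs))) (map-id-local (tabulateᴬ (λ x∈ → gf (P-filter x∈))))
  !image : Unique (map f (filter P? xs))
  !image = Unique.map⁻ (subst Unique (sym g∘f≡id) (Unique.filter⁺ P? !xs))
  image⊆ : ∀ {y} → y ∈ map f (filter P? xs) → y ∈ filter Q? ys
  image⊆ y∈ with ∈-map⁻ f y∈
  ... | x , x∈ , refl = ∈-filter⁺ Q? (ys-all (f x)) (f-pres (P-filter x∈))
  image⊇ : ∀ {y} → y ∈ filter Q? ys → y ∈ map f (filter P? xs)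
  image⊇ {y} y∈ = subst (_∈ map f (filter P? xs)) (fg Qy) (∈-map⁺ f (∈-filter⁺ P? (xs-all (g y)) (g-pres Qy)))
    where
    Qy : Q y
    Qy = proj₂ (∈-filter⁻ Q? {xs = ys} y∈)

vecs-suc : {A : Set} (xs : List A) (n : ℕ) → vecs xs (suc n) ≡ cartesianProductWith _∷_ xs (vecs xs n)
vecs-suc xs n = go xs
  where
  go : ∀ ys → concatMap (λ x → map (x ∷_) (vecs xs n)) ys ≡ cartesianProductWith _∷_ ys (vecs xs n)
  go []       = refl
  go (y ∷ ys) = cong (map (y ∷_) (vecs xs n) ++_) (go ys)

vecs-complete : {A : Set} {xs : List A} → (∀ x → x ∈ xs) → ∀ {n} (v : Vec A n) → v ∈ vecs xs n
vecs-complete xs-all []                       = here refl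
vecs-complete {xs = xs} xs-all {suc n} (x ∷ v) =
  subst ((x ∷ v) ∈_) (sym (vecs-suc xs n)) (∈-cartesianProductWith⁺ _∷_ (xs-all x) (vecs-complete xs-all v))

vecs-unique : {A : Set} {xs : List A} → Unique xs → ∀ n → Unique (vecs xs n)
vecs-unique !xs zero              = [] ∷ []
vecs-unique {xs = xs} !xs (suc n) =
  subst Unique (sym (vecs-suc xs n)) (Unique.cartesianProductWith⁺ _∷_ ∷-injective !xs (vecs-unique !xs n))

bools-complete : ∀ b → b ∈ true ∷ false ∷ []
bools-complete true  = here refl
bools-complete false = there (here refl)

bools-unique : Unique (true ∷ false ∷ [])
bools-unique = ((λ ()) ∷ []) ∷ [] ∷ []

length-filter-allBRel-bij : ∀ {m n} {P : Pred (BRel m) 0ℓ} {Q : Pred (BRel n) 0ℓ}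
  (P? : Decidable P) (Q? : Decidable Q) (f : BRel m → BRel n) (g : BRel n → BRel m) →
  (∀ {R} → P R → Q (f R)) → (∀ {S} → Q S → P (g S)) →
  (∀ {R} → P R → g (f R) ≡ R) → (∀ {S} → Q S → f (g S) ≡ S) →
  length (filter P? (allBRel m)) ≡ length (filter Q? (allBRel n))
length-filter-allBRel-bij {m} {n} P? Q? =
  length-filter-bij P? Q? (allBRel-unique m) (allBRel-unique n) allBRel-complete allBRel-complete
  where
  allBRel-unique : ∀ n → Unique (allBRel n)
  allBRel-unique n = vecs-unique (vecs-unique bools-unique n) n
  allBRel-complete : ∀ {n} (R : BRel n) → R ∈ allBRel n
  allBRel-complete = vecs-complete (vecs-complete bools-complete)

entry : ∀ {n} → BRel n → Fin n → Fin n → Bool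
entry R i j = lookup (lookup R i) j

lookup-ext : ∀ {A : Set} {n} {u v : Vec A n} → (∀ i → lookup u i ≡ lookup v i) → u ≡ v
lookup-ext {u = u} {v} eq = trans (sym (tabulate∘lookup u)) (trans (tabulate-cong eq) (tabulate∘lookup v))

BRel-ext : ∀ {n} {R S : BRel n} → (∀ i j → entry R i j ≡ entry S i j) → R ≡ S
BRel-ext eq = lookup-ext (λ i → lookup-ext (eq i))

≡true-ext : {a b : Bool} → (a ≡ true ⇔ b ≡ true) → a ≡ b
≡true-ext {false} {false} _   = refl
≡true-ext {false} {true}  a⇔b = from a⇔b refl
≡true-ext {true}          a⇔b = sym (to a⇔b refl)

rel-ext : ∀ {n} {R S : BRel n} → (∀ i j → rel R i j ⇔ rel S i j) → R ≡ S
rel-ext iff = BRel-ext (λ i j → ≡true-ext (iff i j))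

tabulateBRel : ∀ {n} → (Fin n → Fin n → Bool) → BRel n
tabulateBRel f = tabulate (λ i → tabulate (f i))

entry-tabulateBRel : ∀ {n} (f : Fin n → Fin n → Bool) i j → entry (tabulateBRel f) i j ≡ f i j
entry-tabulateBRel f i j = trans (cong (λ row → lookup row j) (lookup∘tabulate _ i)) (lookup∘tabulate (f i) j)

comap : ∀ {m n} → (Fin m → Fin n) → BRel n → BRel m
comap f R = tabulateBRel (λ i j → entry R (f i) (f j))

fromDec : ∀ {n} {P : Fin n → Fin n → Set} → (∀ i j → Dec (P i j)) → BRel n
fromDec P? = tabulateBRel (λ i j → does (P? i j))

does≡true⇔ : {P : Set} (P? : Dec P) → does P? ≡ true ⇔ P
does≡true⇔ (yes p) = mk⇔ (λ _ → p) (λ _ → refl)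
does≡true⇔ (no ¬p) = mk⇔ (λ ()) (λ p → contradiction p ¬p)

rel-fromDec : ∀ {n} {P : Fin n → Fin n → Set} (P? : ∀ i j → Dec (P i j)) {i j} → rel (fromDec P?) i j ⇔ P i j
rel-fromDec P? {i} {j} rewrite entry-tabulateBRel (λ i j → does (P? i j)) i j = does≡true⇔ (P? i j)

fromDec-isPartition : ∀ {n} {P : Fin n → Fin n → Set} (P? : ∀ i j → Dec (P i j)) →
  IsEquivalence P → IsPartition (fromDec P?)
fromDec-isPartition {P = P} P? isEq =
  (λ _ → from P⇔ E.refl) ,
  (λ _ _ r → from P⇔ (E.sym (to P⇔ r))) ,
  (λ _ _ _ r s → from P⇔ (E.trans (to P⇔ r) (to P⇔ s)))
  where
  module E = IsEquivalence isEq
  P⇔ : ∀ {i j} → rel (fromDec P?) i j ⇔ P i j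
  P⇔ = rel-fromDec P?

isSingleton-fromDec : ∀ {n} {P : Fin n → Fin n → Set} (P? : ∀ i j → Dec (P i j)) {i} →
  IsSingleton (fromDec P?) i ⇔ (∀ j → P i j → j ≡ i)
isSingleton-fromDec P? =
  mk⇔ (λ single j p → single j (from (rel-fromDec P?) p)) (λ single j r → single j (to (rel-fromDec P?) r))

isSingleton-rel : ∀ {n} (R : BRel n) {i j} → IsSingleton R i → rel R i j → IsSingleton R j
isSingleton-rel R {j = j} single r = subst (IsSingleton R) (sym (single j r)) single

nonSingleton⇒partner : ∀ {n} {R : BRel n} {i} → ¬ IsSingleton R i → ∃[ j ] rel R i j × j ≢ i
nonSingleton⇒partner {R = R} {i} ¬single with any? (λ j → rel? R i j ×-dec ¬? (j ≟ i))
... | yes partner = partner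
... | no ¬partner = contradiction single ¬single
  where
  single : IsSingleton R i
  single j r = decidable-stable (j ≟ i) (λ j≢i → ¬partner (j , r , j≢i))

-- Partitions without singletons from a given position on

NoSingletonFrom : ∀ {n} → ℕ → BRel n → Set
NoSingletonFrom k R = ∀ j → k ≤ toℕ j → ¬ IsSingleton R j

PartitionNoSingletonFrom : ∀ {n} → ℕ → BRel n → Set
PartitionNoSingletonFrom k R = IsPartition R × NoSingletonFrom k R

partitionNoSingletonFrom? : ∀ {n} (k : ℕ) (R : BRel n) → Dec (PartitionNoSingletonFrom k R)
partitionNoSingletonFrom? k R = isPartition? R ×-dec all? (λ j → (k ≤? toℕ j) →-dec ¬? (isSingleton? R j))

countNoSingletonFrom : ℕ → ℕ → ℕ
countNoSingletonFrom m k = length (filter (partitionNoSingletonFrom? k) (allBRel m))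

B≡countNoSingletonFrom : ∀ m → B m ≡ countNoSingletonFrom m m
B≡countNoSingletonFrom m = cong length (filter-≐ isPartition? (partitionNoSingletonFrom? m)
  ((λ p → p , λ j m≤j → contradiction (toℕ<n j) (λ j<m → <-irrefl refl (≤-trans j<m m≤j))) , proj₁)
  (allBRel m))

V≡countNoSingletonFrom : ∀ m → V m ≡ countNoSingletonFrom m 0
V≡countNoSingletonFrom m = cong length (filter-≐ _ (partitionNoSingletonFrom? 0)
  ((λ (p , none) → p , λ j _ → none j) , (λ (p , none) → p , λ j → none j z≤n))
  (allBRel m))

-- Inserting and removing a singleton block

data PunchInView {n} (k : Fin (suc n)) : Fin (suc n) → Set where
  at-k    : PunchInView k k
  punched : ∀ i → PunchInView k (punchIn k i)

punchInView : ∀ {n} (k x : Fin (suc n)) → PunchInView k x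
punchInView k x with k ≟ x
... | yes refl = at-k
... | no k≢x   = subst (PunchInView k) (punchIn-punchOut k≢x) (punched (punchOut k≢x))

≤⇒<punchIn : ∀ {n} (k : Fin (suc n)) i → toℕ k ≤ toℕ i → toℕ k < toℕ (punchIn k i)
≤⇒<punchIn 0F       i        _       = s≤s z≤n
≤⇒<punchIn (sucF k) (sucF i) (s≤s p) = s≤s (≤⇒<punchIn k i p)

<punchIn⇒≤ : ∀ {n} (k : Fin (suc n)) i → toℕ k < toℕ (punchIn k i) → toℕ k ≤ toℕ i
<punchIn⇒≤ 0F       i        _       = z≤n
<punchIn⇒≤ (sucF k) (sucF i) (s≤s p) = s≤s (<punchIn⇒≤ k i p)

false⇒¬true : ∀ {b} → b ≡ false → ¬ b ≡ true
false⇒¬true refl ()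

record IsSingletonInsertion {n} (k : Fin (suc n)) (S : BRel n) (T : BRel (suc n)) : Set where
  field
    k∼k      : entry T k k ≡ true
    k≁       : ∀ j → entry T k (punchIn k j) ≡ false
    ≁k       : ∀ i → entry T (punchIn k i) k ≡ false
    restrict : ∀ i j → entry T (punchIn k i) (punchIn k j) ≡ entry S i j

  isPartition⁺ : IsPartition S → IsPartition T
  isPartition⁺ (reflS , symS , transS) = reflT , symT , transT
    where
    reflT : ∀ x → rel T x x
    reflT x with punchInView k x
    ... | at-k      = k∼k
    ... | punched i = trans (restrict i i) (reflS i)
    symT : ∀ x y → rel T x y → rel T y x
    symT x y r with punchInView k x | punchInView k y
    ... | at-k      | at-k      = r
    ... | at-k      | punched j = contradiction r (false⇒¬true (k≁ j))
    ... | punched i | at-k      = contradiction r (false⇒¬true (≁k i))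
    ... | punched i | punched j = trans (restrict j i) (symS i j (trans (sym (restrict i j)) r))
    transT : ∀ x y z → rel T x y → rel T y z → rel T x z
    transT x y z r s with punchInView k x | punchInView k y | punchInView k z
    ... | at-k      | at-k      | _         = s
    ... | _         | at-k      | at-k      = r
    ... | at-k      | punched j | _         = contradiction r (false⇒¬true (k≁ j))
    ... | punched i | at-k      | _         = contradiction r (false⇒¬true (≁k i))
    ... | _         | punched j | at-k      = contradiction s (false⇒¬true (≁k j))
    ... | punched i | punched j | punched l =
      trans (restrict i l) (transS i j l (trans (sym (restrict i j)) r) (trans (sym (restrict j l)) s))

  isPartition⁻ : IsPartition T → IsPartition S
  isPartition⁻ (reflT , symT , transT) =
    (λ i → trans (sym (restrict i i)) (reflT _)) ,
    (λ i j r → trans (sym (restrict j i)) (symT _ _ (trans (restrict i j) r))) ,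
    (λ i j l r s → trans (sym (restrict i l)) (transT _ _ _ (trans (restrict i j) r) (trans (restrict j l) s)))

  isSingleton-k : IsSingleton T k
  isSingleton-k x r with punchInView k x
  ... | at-k      = refl
  ... | punched j = contradiction r (false⇒¬true (k≁ j))

  isSingleton⁺ : ∀ i → IsSingleton S i → IsSingleton T (punchIn k i)
  isSingleton⁺ i single x r with punchInView k x
  ... | at-k      = contradiction r (false⇒¬true (≁k i))
  ... | punched j = cong (punchIn k) (single j (trans (sym (restrict i j)) r))

  isSingleton⁻ : ∀ i → IsSingleton T (punchIn k i) → IsSingleton S i
  isSingleton⁻ i single j r = punchIn-injective k j i (single (punchIn k j) (trans (restrict i j) r))

  noSingletonAbove⁺ : NoSingletonFrom (toℕ k) S → ∀ x → toℕ k < toℕ x → ¬ IsSingleton T x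
  noSingletonAbove⁺ none x k<x single with punchInView k x
  ... | at-k      = <-irrefl refl k<x
  ... | punched i = none i (<punchIn⇒≤ k i k<x) (isSingleton⁻ i single)

  noSingletonAbove⁻ : (∀ x → toℕ k < toℕ x → ¬ IsSingleton T x) → NoSingletonFrom (toℕ k) S
  noSingletonAbove⁻ none j k≤j single = none (punchIn k j) (≤⇒<punchIn k j k≤j) (isSingleton⁺ j single)

isSingletonInsertion-unique : ∀ {n} {k : Fin (suc n)} {S : BRel n} {T T′ : BRel (suc n)} →
  IsSingletonInsertion k S T → IsSingletonInsertion k S T′ → T ≡ T′
isSingletonInsertion-unique {k = k} {T = T} {T′} ins ins′ = BRel-ext same
  where
  open IsSingletonInsertion
  same : ∀ x y → entry T x y ≡ entry T′ x y
  same x y with punchInView k x | punchInView k y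
  ... | at-k      | at-k      = trans (k∼k ins) (sym (k∼k ins′))
  ... | at-k      | punched j = trans (k≁ ins j) (sym (k≁ ins′ j))
  ... | punched i | at-k      = trans (≁k ins i) (sym (≁k ins′ i))
  ... | punched i | punched j = trans (restrict ins i j) (sym (restrict ins′ i j))

insertSingleton : ∀ {n} → Fin (suc n) → BRel n → BRel (suc n)
insertSingleton {n} k S = insertAt (mapᵥ (λ row → insertAt row k false) S) k (insertAt (replicate n false) k true)

removeSingleton : ∀ {n} → Fin (suc n) → BRel (suc n) → BRel n
removeSingleton k = comap (punchIn k)

insertSingleton-isSingletonInsertion : ∀ {n} (k : Fin (suc n)) (S : BRel n) →
  IsSingletonInsertion k S (insertSingleton k S)
insertSingleton-isSingletonInsertion {n} k S = record
  { k∼k      = trans (row-k k) (insertAt-lookup _ k true)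
  ; k≁       = λ j → trans (row-k (punchIn k j)) (trans (insertAt-punchIn _ k true j) (lookup-replicate j false))
  ; ≁k       = λ i → trans (row-punchIn i k) (insertAt-lookup _ k false)
  ; restrict = λ i j → trans (row-punchIn i (punchIn k j)) (insertAt-punchIn _ k false j)
  }
  where
  rows : Vec (Vec Bool (suc n)) n
  rows = mapᵥ (λ row → insertAt row k false) S
  new-row : Vec Bool (suc n)
  new-row = insertAt (replicate n false) k true
  row-k : ∀ y → entry (insertSingleton k S) k y ≡ lookup new-row y
  row-k y = cong (λ row → lookup row y) (insertAt-lookup rows k new-row)
  row-punchIn : ∀ i y → entry (insertSingleton k S) (punchIn k i) y ≡ lookup (insertAt (lookup S i) k false) y
  row-punchIn i y = cong (λ row → lookup row y) (trans (insertAt-punchIn rows k new-row i) (lookup-map i _ S))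

removeSingleton-isSingletonInsertion : ∀ {n} (k : Fin (suc n)) (R : BRel (suc n)) →
  IsPartition R → IsSingleton R k → IsSingletonInsertion k (removeSingleton k R) R
removeSingleton-isSingletonInsertion k R (reflR , symR , _) single = record
  { k∼k      = reflR k
  ; k≁       = λ j → ¬true⇒false (λ r → punchInᵢ≢i k j (single _ r))
  ; ≁k       = λ i → ¬true⇒false (λ r → punchInᵢ≢i k i (single _ (symR _ _ r)))
  ; restrict = λ i j → sym (entry-tabulateBRel _ i j)
  }
  where
  ¬true⇒false : ∀ {b} → ¬ b ≡ true → b ≡ false
  ¬true⇒false {false} _      = refl
  ¬true⇒false {true}  ¬true = contradiction refl ¬true

A≡countNoSingletonFrom : ∀ n (k : Fin (suc n)) → A n k ≡ countNoSingletonFrom n (toℕ k)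
A≡countNoSingletonFrom n k =
  length-filter-allBRel-bij _ (partitionNoSingletonFrom? (toℕ k)) (removeSingleton k) (insertSingleton k)
    (λ {R} (p , single , none) → let open IsSingletonInsertion (removed {R} p single) in
                             isPartition⁻ p , noSingletonAbove⁻ none)
    (λ (p , none) → let open IsSingletonInsertion (inserted _) in
                    isPartition⁺ p , isSingleton-k , noSingletonAbove⁺ none)
    (λ {R} (p , single , _) → isSingletonInsertion-unique (inserted _) (removed {R} p single))
    (λ {S} _ → BRel-ext (λ i j → trans (entry-tabulateBRel _ i j) (IsSingletonInsertion.restrict (inserted S) i j)))
  where
  inserted : ∀ S → IsSingletonInsertion k S (insertSingleton k S)
  inserted = insertSingleton-isSingletonInsertion k
  removed : ∀ {R} → IsPartition R → IsSingleton R k → IsSingletonInsertion k (removeSingleton k R) R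
  removed = removeSingleton-isSingletonInsertion k _

noSingletonFrom-pred : ∀ {n} {R : BRel n} {k} → NoSingletonFrom (suc (toℕ k)) R → ¬ IsSingleton R k →
  NoSingletonFrom (toℕ k) R
noSingletonFrom-pred {R = R} none ¬single j k≤j with m≤n⇒m<n∨m≡n k≤j
... | inj₁ k<j = none j k<j
... | inj₂ k≡j = subst (λ x → ¬ IsSingleton R x) (toℕ-injective k≡j) ¬single

countNoSingletonFrom-suc : ∀ n (k : Fin (suc n)) →
  countNoSingletonFrom (suc n) (suc (toℕ k)) ≡ countNoSingletonFrom (suc n) (toℕ k) + A n k
countNoSingletonFrom-suc n k = begin
  countNoSingletonFrom (suc n) (suc (toℕ k))
    ≡⟨ length-filter-split (partitionNoSingletonFrom? (suc (toℕ k))) (λ R → isSingleton? R k) (allBRel (suc n)) ⟩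
  length (filter (partitionNoSingletonFrom? (suc (toℕ k)) ∩? (λ R → isSingleton? R k)) (allBRel (suc n))) +
  length (filter (partitionNoSingletonFrom? (suc (toℕ k)) ∩? ∁? (λ R → isSingleton? R k)) (allBRel (suc n)))
    ≡⟨ cong₂ _+_ (cong length (filter-≐ _ _ largest (allBRel (suc n))))
                 (cong length (filter-≐ _ _ notSingleton (allBRel (suc n)))) ⟩
  A n k + countNoSingletonFrom (suc n) (toℕ k)
    ≡⟨ +-comm (A n k) _ ⟩
  countNoSingletonFrom (suc n) (toℕ k) + A n k ∎
  where
  open ≡-Reasoning
  largest : (PartitionNoSingletonFrom (suc (toℕ k)) ∩ (λ R → IsSingleton R k)) ≐
            (λ R → IsPartition R × LargestSingleton R k)
  largest = (λ ((p , none) , single) → p , single , none) , (λ (p , single , none) → (p , none) , single)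
  notSingleton : (PartitionNoSingletonFrom (suc (toℕ k)) ∩ ∁ (λ R → IsSingleton R k)) ≐
                 PartitionNoSingletonFrom (toℕ k)
  notSingleton = (λ {R} ((p , none) , ¬single) → p , noSingletonFrom-pred {R = R} none ¬single) ,
                 (λ (p , none) → (p , λ j k<j → none j (≤-trans (n≤1+n _) k<j)) , none k ≤-refl)

countNoSingletonFrom-step : ∀ n k → k < suc n →
  countNoSingletonFrom (suc n) (suc k) ≡ countNoSingletonFrom (suc n) k + countNoSingletonFrom n k
countNoSingletonFrom-step n k k<1+n =
  subst (λ x → countNoSingletonFrom (suc n) (suc x) ≡ countNoSingletonFrom (suc n) x + countNoSingletonFrom n x)
    (toℕ-fromℕ< k<1+n)
    (trans (countNoSingletonFrom-suc n K) (cong (countNoSingletonFrom (suc n) (toℕ K) +_) (A≡countNoSingletonFrom n K)))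
  where
  K : Fin (suc n)
  K = fromℕ< k<1+n

-- Absorbing all singletons into the block of a new element

AbsorbSingletons : ∀ {m} → BRel m → Fin (suc m) → Fin (suc m) → Set
AbsorbSingletons R 0F       0F       = ⊤
AbsorbSingletons R 0F       (sucF j) = IsSingleton R j
AbsorbSingletons R (sucF i) 0F       = IsSingleton R i
AbsorbSingletons R (sucF i) (sucF j) = rel R i j ⊎ IsSingleton R i × IsSingleton R j

absorbSingletons? : ∀ {m} (R : BRel m) x y → Dec (AbsorbSingletons R x y)
absorbSingletons? R 0F       0F       = yes tt
absorbSingletons? R 0F       (sucF j) = isSingleton? R j
absorbSingletons? R (sucF i) 0F       = isSingleton? R i
absorbSingletons? R (sucF i) (sucF j) = rel? R i j ⊎-dec (isSingleton? R i ×-dec isSingleton? R j)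

absorbSingletons : ∀ {m} → BRel m → BRel (suc m)
absorbSingletons R = fromDec (absorbSingletons? R)

SplitBlockOfZero : ∀ {m} → BRel (suc m) → Fin m → Fin m → Set
SplitBlockOfZero Q i j = rel Q (sucF i) (sucF j) × (rel Q 0F (sucF i) → i ≡ j)

splitBlockOfZero? : ∀ {m} (Q : BRel (suc m)) i j → Dec (SplitBlockOfZero Q i j)
splitBlockOfZero? Q i j = rel? Q (sucF i) (sucF j) ×-dec (rel? Q 0F (sucF i) →-dec (i ≟ j))

splitBlockOfZero : ∀ {m} → BRel (suc m) → BRel m
splitBlockOfZero Q = fromDec (splitBlockOfZero? Q)

absorbSingletons-isEquivalence : ∀ {m} (R : BRel m) → IsPartition R → IsEquivalence (AbsorbSingletons R)
absorbSingletons-isEquivalence R (reflR , symR , transR) = record { refl = refl′ ; sym = sym′ ; trans = trans′ }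
  where
  refl′ : ∀ {x} → AbsorbSingletons R x x
  refl′ {0F}     = tt
  refl′ {sucF i} = inj₁ (reflR i)
  sym′ : ∀ {x y} → AbsorbSingletons R x y → AbsorbSingletons R y x
  sym′ {0F}     {0F}     _              = tt
  sym′ {0F}     {sucF _} single         = single
  sym′ {sucF _} {0F}     single         = single
  sym′ {sucF i} {sucF j} (inj₁ r)       = inj₁ (symR i j r)
  sym′ {sucF _} {sucF _} (inj₂ (s , t)) = inj₂ (t , s)
  trans′ : ∀ {x y z} → AbsorbSingletons R x y → AbsorbSingletons R y z → AbsorbSingletons R x z
  trans′ {0F}     {0F}     {_}      _ s = s
  trans′ {_}      {0F}     {0F}     r _ = r
  trans′ {0F}     {sucF _} {0F}     _ _ = tt
  trans′ {0F}     {sucF _} {sucF _} s (inj₁ r)       = isSingleton-rel R s r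
  trans′ {0F}     {sucF _} {sucF _} _ (inj₂ (_ , t)) = t
  trans′ {sucF _} {0F}     {sucF _} s t = inj₂ (s , t)
  trans′ {sucF i} {sucF j} {0F}     (inj₁ r)       t = isSingleton-rel R t (symR i j r)
  trans′ {sucF _} {sucF _} {0F}     (inj₂ (s , _)) _ = s
  trans′ {sucF i} {sucF j} {sucF l} (inj₁ r₁)      (inj₁ r₂)      = inj₁ (transR i j l r₁ r₂)
  trans′ {sucF i} {sucF j} {sucF _} (inj₁ r)       (inj₂ (s , t)) = inj₂ (isSingleton-rel R s (symR i j r) , t)
  trans′ {sucF _} {sucF _} {sucF _} (inj₂ (s , t)) (inj₁ r)       = inj₂ (s , isSingleton-rel R t r)
  trans′ {sucF _} {sucF _} {sucF _} (inj₂ (s , _)) (inj₂ (_ , t)) = inj₂ (s , t)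

splitBlockOfZero-isEquivalence : ∀ {m} (Q : BRel (suc m)) → IsPartition Q → IsEquivalence (SplitBlockOfZero Q)
splitBlockOfZero-isEquivalence Q (reflQ , symQ , transQ) = record
  { refl  = reflQ _ , λ _ → refl
  ; sym   = λ (r , same) → symQ _ _ r , λ q → sym (same (transQ _ _ _ q (symQ _ _ r)))
  ; trans = λ (r₁ , same₁) (r₂ , same₂) →
      transQ _ _ _ r₁ r₂ , λ q → trans (same₁ q) (same₂ (transQ _ _ _ q r₁))
  }

absorbSingletons-noSingletonFrom1 : ∀ {m} (R : BRel m) → NoSingletonFrom 1 (absorbSingletons R)
absorbSingletons-noSingletonFrom1 R (sucF i) _ single = excluded (isSingleton? R i)
  where
  single′ : ∀ x → AbsorbSingletons R (sucF i) x → x ≡ sucF i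
  single′ = to (isSingleton-fromDec (absorbSingletons? R)) single
  excluded : Dec (IsSingleton R i) → ⊥
  excluded (yes s)  = contradiction (single′ 0F s) (λ ())
  excluded (no ¬s) = let j , r , j≢i = nonSingleton⇒partner {R = R} ¬s in
                     j≢i (suc-injective (single′ (sucF j) (inj₁ r)))

splitBlockOfZero-absorbSingletons : ∀ {m} (R : BRel m) → IsPartition R → splitBlockOfZero (absorbSingletons R) ≡ R
splitBlockOfZero-absorbSingletons R (reflR , _) =
  rel-ext (λ i j → ⇔.trans (rel-fromDec (splitBlockOfZero? (absorbSingletons R))) (mk⇔ (split⇒ i j) (split⇐ i j)))
  where
  absorbed : ∀ {x y} → rel (absorbSingletons R) x y ⇔ AbsorbSingletons R x y
  absorbed = rel-fromDec (absorbSingletons? R)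
  split⇒ : ∀ i j → SplitBlockOfZero (absorbSingletons R) i j → rel R i j
  split⇒ i j (r , same) with to (absorbed {sucF i} {sucF j}) r
  ... | inj₁ r′          = r′
  ... | inj₂ (single , _) = subst (rel R i) (same (from (absorbed {0F} {sucF i}) single)) (reflR i)
  split⇐ : ∀ i j → rel R i j → SplitBlockOfZero (absorbSingletons R) i j
  split⇐ i j r = from (absorbed {sucF i} {sucF j}) (inj₁ r) , λ q → sym (to (absorbed {0F} {sucF i}) q j r)

isSingleton-splitBlockOfZero : ∀ {m} (Q : BRel (suc m)) → IsPartition Q → NoSingletonFrom 1 Q → ∀ i →
  IsSingleton (splitBlockOfZero Q) i ⇔ rel Q 0F (sucF i)
isSingleton-splitBlockOfZero Q (_ , symQ , _) none i =
  ⇔.trans (isSingleton-fromDec (splitBlockOfZero? Q)) (mk⇔ zero∼ single)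
  where
  single : rel Q 0F (sucF i) → ∀ j → SplitBlockOfZero Q i j → j ≡ i
  single q j (_ , same) = sym (same q)
  zero∼ : (∀ j → SplitBlockOfZero Q i j → j ≡ i) → rel Q 0F (sucF i)
  zero∼ single′ with rel? Q 0F (sucF i)
  ... | yes q = q
  ... | no ¬q with nonSingleton⇒partner {R = Q} (none (sucF i) (s≤s z≤n))
  ...   | 0F     , r , _   = contradiction (symQ _ _ r) ¬q
  ...   | sucF l , r , l≢i = contradiction (cong sucF (single′ l (r , λ q → contradiction q ¬q))) l≢i

absorbSingletons-splitBlockOfZero : ∀ {m} (Q : BRel (suc m)) → IsPartition Q → NoSingletonFrom 1 Q →
  absorbSingletons (splitBlockOfZero Q) ≡ Q
absorbSingletons-splitBlockOfZero Q pQ@(reflQ , symQ , transQ) none =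
  rel-ext (λ x y → ⇔.trans (rel-fromDec (absorbSingletons? (splitBlockOfZero Q))) (absorbed⇔ x y))
  where
  split⇔ : ∀ {i j} → rel (splitBlockOfZero Q) i j ⇔ SplitBlockOfZero Q i j
  split⇔ = rel-fromDec (splitBlockOfZero? Q)
  singleton⇔ : ∀ i → IsSingleton (splitBlockOfZero Q) i ⇔ rel Q 0F (sucF i)
  singleton⇔ = isSingleton-splitBlockOfZero Q pQ none
  absorbed⇒ : ∀ i j → AbsorbSingletons (splitBlockOfZero Q) (sucF i) (sucF j) → rel Q (sucF i) (sucF j)
  absorbed⇒ i j (inj₁ r)       = proj₁ (to split⇔ r)
  absorbed⇒ i j (inj₂ (s , t)) = transQ _ _ _ (symQ _ _ (to (singleton⇔ i) s)) (to (singleton⇔ j) t)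
  absorbed⇐ : ∀ i j → rel Q (sucF i) (sucF j) → AbsorbSingletons (splitBlockOfZero Q) (sucF i) (sucF j)
  absorbed⇐ i j q with rel? Q 0F (sucF i)
  ... | yes z = inj₂ (from (singleton⇔ i) z , from (singleton⇔ j) (transQ _ _ _ z q))
  ... | no ¬z = inj₁ (from split⇔ (q , λ z → contradiction z ¬z))
  absorbed⇔ : ∀ x y → AbsorbSingletons (splitBlockOfZero Q) x y ⇔ rel Q x y
  absorbed⇔ 0F       0F       = mk⇔ (λ _ → reflQ 0F) (λ _ → tt)
  absorbed⇔ 0F       (sucF j) = singleton⇔ j
  absorbed⇔ (sucF i) 0F       =
    mk⇔ (λ s → symQ _ _ (to (singleton⇔ i) s)) (λ q → from (singleton⇔ i) (symQ _ _ q))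
  absorbed⇔ (sucF i) (sucF j) = mk⇔ (absorbed⇒ i j) (absorbed⇐ i j)

B≡countNoSingletonFrom1 : ∀ m → B m ≡ countNoSingletonFrom (suc m) 1
B≡countNoSingletonFrom1 m =
  length-filter-allBRel-bij {m} {suc m} isPartition? (partitionNoSingletonFrom? 1)
    absorbSingletons splitBlockOfZero
    (λ {R} p → fromDec-isPartition (absorbSingletons? R) (absorbSingletons-isEquivalence R p) ,
               absorbSingletons-noSingletonFrom1 R)
    (λ {Q} (p , _) → fromDec-isPartition (splitBlockOfZero? Q) (splitBlockOfZero-isEquivalence Q p))
    (λ {R} → splitBlockOfZero-absorbSingletons R)
    (λ {Q} (p , none) → absorbSingletons-splitBlockOfZero Q p none)

B≡V+V : ∀ m → B m ≡ V (suc m) + V m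
B≡V+V m = begin
  B m                                                       ≡⟨ B≡countNoSingletonFrom1 m ⟩
  countNoSingletonFrom (suc m) 1                            ≡⟨ countNoSingletonFrom-step m 0 (s≤s z≤n) ⟩
  countNoSingletonFrom (suc m) 0 + countNoSingletonFrom m 0 ≡⟨ cong₂ _+_ (V≡countNoSingletonFrom (suc m))
                                                                          (V≡countNoSingletonFrom m) ⟨
  V (suc m) + V m                                           ∎
  where open ≡-Reasoning

-- Finite sums

sumBelow : ℕ → (ℕ → ℕ) → ℕ
sumBelow zero    f = 0
sumBelow (suc m) f = sumBelow m f + f m

sumBelow-suc : ∀ m f → sumBelow (suc m) f ≡ f 0 + sumBelow m (λ k → f (suc k))
sumBelow-suc zero    f = +-comm 0 (f 0)
sumBelow-suc (suc m) f = trans (cong (_+ f (suc m)) (sumBelow-suc m f)) (+-assoc (f 0) _ _)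

sum-tabulate : ∀ m (f : Fin m → ℕ) (g : ℕ → ℕ) → (∀ k → f k ≡ g (toℕ k)) → sum (tabulateˡ f) ≡ sumBelow m g
sum-tabulate zero    f g f≡g = refl
sum-tabulate (suc m) f g f≡g =
  trans (cong₂ _+_ (f≡g 0F) (sum-tabulate m (λ k → f (sucF k)) (λ k → g (suc k)) (λ k → f≡g (sucF k))))
        (sym (sumBelow-suc m g))

sumTo≡sumBelow : ∀ n (f : Fin (suc n) → ℕ) (g : ℕ → ℕ) → (∀ k → f k ≡ g (toℕ k)) →
  sumTo n f ≡ sumBelow (suc n) g
sumTo≡sumBelow n f g f≡g = trans (cong sum (map-tabulate (λ k → k) f)) (sum-tabulate (suc n) f g f≡g)

sumBelow-cong : ∀ m {f g : ℕ → ℕ} → (∀ k → k < m → f k ≡ g k) → sumBelow m f ≡ sumBelow m g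
sumBelow-cong zero    f≡g = refl
sumBelow-cong (suc m) f≡g = cong₂ _+_ (sumBelow-cong m (λ k k<m → f≡g k (m<n⇒m<1+n k<m))) (f≡g m ≤-refl)

sumBelow-+ : ∀ m f g → sumBelow m f + sumBelow m g ≡ sumBelow m (λ k → f k + g k)
sumBelow-+ zero    f g = refl
sumBelow-+ (suc m) f g =
  trans (+-interchange (sumBelow m f) (f m) (sumBelow m g) (g m)) (cong (_+ (f m + g m)) (sumBelow-+ m f g))

sumBelow-*ˡ : ∀ m c f → sumBelow m (λ k → c * f k) ≡ c * sumBelow m f
sumBelow-*ˡ zero    c f = sym (*-zeroʳ c)
sumBelow-*ˡ (suc m) c f =
  trans (cong (_+ c * f m) (sumBelow-*ˡ m c f)) (sym (*-distribˡ-+ c (sumBelow m f) (f m)))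

module _ (d a : ℕ → ℕ) where

  Increments : ℕ → Set
  Increments m = ∀ k → k < m → d (suc k) ≡ d k + a k

  increments-pred : ∀ {m} → Increments (suc m) → Increments m
  increments-pred inc k k<m = inc k (m<n⇒m<1+n k<m)

  sumBelow-telescope : ∀ m → Increments m → d m ≡ d 0 + sumBelow m a
  sumBelow-telescope zero    _   = sym (+-identityʳ (d 0))
  sumBelow-telescope (suc m) inc = begin
    d (suc m)                    ≡⟨ inc m ≤-refl ⟩
    d m + a m                    ≡⟨ cong (_+ a m) (sumBelow-telescope m (increments-pred inc)) ⟩
    d 0 + sumBelow m a + a m     ≡⟨ +-assoc (d 0) _ _ ⟩
    d 0 + sumBelow (suc m) a     ∎
    where open ≡-Reasoning

  -- m * d m − Σ d j = Σ (d m − d j), and the increment a k occurs in d m − d j for the k + 1 indices j ≤ k.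
  sumBelow-abel : ∀ m → Increments m → sumBelow m (λ k → (k + 1) * a k) + sumBelow m d ≡ m * d m
  sumBelow-abel zero    _   = refl
  sumBelow-abel (suc m) inc = begin
    (W + (m + 1) * a m) + (sumBelow m d + d m) ≡⟨ +-interchange W _ (sumBelow m d) _ ⟩
    (W + sumBelow m d) + ((m + 1) * a m + d m) ≡⟨ cong (_+ ((m + 1) * a m + d m)) (sumBelow-abel m (increments-pred inc)) ⟩
    m * d m + ((m + 1) * a m + d m)            ≡⟨ regroup m (d m) (a m) ⟩
    suc m * (d m + a m)                        ≡⟨ cong (suc m *_) (inc m ≤-refl) ⟨
    suc m * d (suc m)                          ∎
    where
    open ≡-Reasoning
    W : ℕ
    W = sumBelow m (λ k → (k + 1) * a k)
    regroup : ∀ m x y → m * x + ((m + 1) * y + x) ≡ suc m * (x + y)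
    regroup = solve-∀

B≡V+sumBelow : ∀ m → B (suc m) ≡ V (suc m) + sumBelow (suc m) (countNoSingletonFrom m)
B≡V+sumBelow m = begin
  B (suc m)
    ≡⟨ B≡countNoSingletonFrom (suc m) ⟩
  countNoSingletonFrom (suc m) (suc m)
    ≡⟨ sumBelow-telescope (countNoSingletonFrom (suc m)) (countNoSingletonFrom m) (suc m) (countNoSingletonFrom-step m) ⟩
  countNoSingletonFrom (suc m) 0 + T
    ≡⟨ cong (_+ T) (V≡countNoSingletonFrom (suc m)) ⟨
  V (suc m) + T ∎
  where
  open ≡-Reasoning
  T : ℕ
  T = sumBelow (suc m) (countNoSingletonFrom m)

V≡sumBelow : ∀ m → V (suc (suc m)) ≡ sumBelow (suc m) (countNoSingletonFrom m)
V≡sumBelow m = +-cancelˡ-≡ (V (suc m)) _ _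
  (trans (+-comm (V (suc m)) _) (trans (sym (B≡V+V (suc m))) (B≡V+sumBelow m)))

weightedSum-identity : ∀ n →
  sumBelow (suc n) (λ k → (k + 1) * countNoSingletonFrom n k) + V (suc (suc (suc n))) ≡ (n + 2) * B (suc n)
weightedSum-identity n = begin
  S₁ + V (suc (suc (suc n)))                       ≡⟨ cong (S₁ +_) (V≡sumBelow (suc n)) ⟩
  S₁ + (Sd + countNoSingletonFrom (suc n) (suc n)) ≡⟨ cong (λ x → S₁ + (Sd + x)) (B≡countNoSingletonFrom (suc n)) ⟨
  S₁ + (Sd + B (suc n))                            ≡⟨ +-assoc S₁ Sd _ ⟨
  (S₁ + Sd) + B (suc n)                            ≡⟨ cong (_+ B (suc n)) abel ⟩
  suc n * B (suc n) + B (suc n)                    ≡⟨ collect n (B (suc n)) ⟩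
  (n + 2) * B (suc n)                              ∎
  where
  open ≡-Reasoning
  S₁ Sd : ℕ
  S₁ = sumBelow (suc n) (λ k → (k + 1) * countNoSingletonFrom n k)
  Sd = sumBelow (suc n) (countNoSingletonFrom (suc n))
  collect : ∀ n b → suc n * b + b ≡ (n + 2) * b
  collect = solve-∀
  abel : S₁ + Sd ≡ suc n * B (suc n)
  abel = trans (sumBelow-abel (countNoSingletonFrom (suc n)) (countNoSingletonFrom n) (suc n)
                              (countNoSingletonFrom-step n))
               (cong (suc n *_) (sym (B≡countNoSingletonFrom (suc n))))

complementaryWeights : ∀ n →
  sumBelow (suc n) (λ k → (k + 1) * countNoSingletonFrom n k) +
  sumBelow (suc n) (λ k → (n ∸ k + 1) * countNoSingletonFrom n k)
  ≡ (n + 2) * sumBelow (suc n) (countNoSingletonFrom n)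
complementaryWeights n =
  trans (sumBelow-+ (suc n) _ _)
        (trans (sumBelow-cong (suc n) (λ k k<1+n → trans (sym (*-distribʳ-+ (a k) (k + 1) (n ∸ k + 1)))
                                                          (cong (_* a k) (weights k (s≤s⁻¹ k<1+n)))))
               (sumBelow-*ˡ (suc n) (n + 2) a))
  where
  a : ℕ → ℕ
  a = countNoSingletonFrom n
  weights : ∀ k → k ≤ n → (k + 1) + (n ∸ k + 1) ≡ n + 2
  weights k k≤n = trans (+-interchange k 1 (n ∸ k) 1) (cong (_+ 2) (m+[n∸m]≡n k≤n))

reversedWeightedSum-identity : ∀ n →
  sumBelow (suc n) (λ k → (n ∸ k + 1) * countNoSingletonFrom n k) + (n + 2) * V (suc n) ≡ V (suc (suc (suc n)))
reversedWeightedSum-identity n = +-cancelˡ-≡ S₁ _ _ (begin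
  S₁ + (S₂ + (n + 2) * V (suc n))   ≡⟨ +-assoc S₁ S₂ _ ⟨
  (S₁ + S₂) + (n + 2) * V (suc n)   ≡⟨ cong (_+ (n + 2) * V (suc n)) (complementaryWeights n) ⟩
  (n + 2) * T + (n + 2) * V (suc n) ≡⟨ *-distribˡ-+ (n + 2) T (V (suc n)) ⟨
  (n + 2) * (T + V (suc n))         ≡⟨ cong ((n + 2) *_) (trans (+-comm T (V (suc n))) (sym (B≡V+sumBelow n))) ⟩
  (n + 2) * B (suc n)               ≡⟨ weightedSum-identity n ⟨
  S₁ + V (suc (suc (suc n)))        ∎)
  where
  open ≡-Reasoning
  S₁ S₂ T : ℕ
  S₁ = sumBelow (suc n) (λ k → (k + 1) * countNoSingletonFrom n k)
  S₂ = sumBelow (suc n) (λ k → (n ∸ k + 1) * countNoSingletonFrom n k)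
  T = sumBelow (suc n) (countNoSingletonFrom n)

sumTo-A : ∀ n (w : ℕ → ℕ) →
  sumTo n (λ k → w (toℕ k) * A n k) ≡ sumBelow (suc n) (λ k → w k * countNoSingletonFrom n k)
sumTo-A n w = sumTo≡sumBelow n _ _ (λ k → cong (w (toℕ k) *_) (A≡countNoSingletonFrom n k))

theorem3p10 : (n : ℕ) →
    (sumTo n (λ k → (toℕ k + 1) * A n k) + V (n + 3) ≡ (n + 2) * B (n + 1))
    × (sumTo n (λ k → (n ∸ toℕ k + 1) * A n k) + (n + 2) * V (n + 1) ≡ V (n + 3))
theorem3p10 n = first , second
  where
  open ≡-Reasoning
  first : sumTo n (λ k → (toℕ k + 1) * A n k) + V (n + 3) ≡ (n + 2) * B (n + 1)
  first = begin
    sumTo n (λ k → (toℕ k + 1) * A n k) + V (n + 3)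
      ≡⟨ cong₂ _+_ (sumTo-A n (_+ 1)) (cong V (+-comm n 3)) ⟩
    sumBelow (suc n) (λ k → (k + 1) * countNoSingletonFrom n k) + V (3 + n)
      ≡⟨ weightedSum-identity n ⟩
    (n + 2) * B (1 + n)
      ≡⟨ cong (λ m → (n + 2) * B m) (+-comm 1 n) ⟩
    (n + 2) * B (n + 1) ∎
  second : sumTo n (λ k → (n ∸ toℕ k + 1) * A n k) + (n + 2) * V (n + 1) ≡ V (n + 3)
  second = begin
    sumTo n (λ k → (n ∸ toℕ k + 1) * A n k) + (n + 2) * V (n + 1)
      ≡⟨ cong₂ _+_ (sumTo-A n (λ k → n ∸ k + 1)) (cong (λ m → (n + 2) * V m) (+-comm n 1)) ⟩
    sumBelow (suc n) (λ k → (n ∸ k + 1) * countNoSingletonFrom n k) + (n + 2) * V (1 + n)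
      ≡⟨ reversedWeightedSum-identity n ⟩
    V (3 + n)
      ≡⟨ cong V (+-comm 3 n) ⟩
    V (n + 3) ∎
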